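{- For every integer $n>0$ and every path $P\in T_{n,0,1}$, $$\mathrm{word}(\phi_{n,0,1}(P))=\mathrm{flip}\circ\mathrm{rev}\circ\mathrm{sw}^{ - }_{1,-1}(\mathrm{word}(P)).$$
   Context: Words in $\{\mathrm{N},\mathrm{E}\}^*$ are identified with lattice paths from $(0,0)$ using unit north ($\mathrm{N}$) and east ($\mathrm{E}$) steps; $\mathrm{word}(P)$ is the word of a path $P$. $\mathrm{rev}$ reverses a word; $\mathrm{flip}$ interchanges the letters $\mathrm{N}$ and $\mathrm{E}$. For $w=w_1\cdots w_N$ define levels $l_0=0$, $l_i=l_{i-1}+1$ if $w_i=\mathrm{N}$ and $l_i=l_{i-1}-1$ if $w_i=\mathrm{E}$. The word $\mathrm{sw}^-_{1,-1}(w)$ is obtained as follows: for $k=-1,-2,-3,\dots$ and then for $k=\dots,3,2,1,0$ (positive values decreasing, ending with $0$), scan $w$ from right to left and append each letter $w_i$ ($i\ge1$) with $l_i=k$. $T_{n,0,1}$ is the set of lattice paths from $(0,0)$ to $(n,n)$ with unit north and east steps that never go strictly to the right of the line $x=y$. For $P\in T_{n,0,1}$ its area vector is $g(P)=(g_0,\dots,g_{n-1})$, where $g_i$ is the number of complete unit squares in the strip $\{x\ge0,\ i\le y\le i+1\}$ lying to the right of $P$ and to the left of the line $x=y$. The map $\phi_{n,0,1}$: for $i\ge0$ let $z^{(i)}$ be the subsequence of $g(P)$ consisting of the entries equal to $i$ or $i-1$; let $M$ be the largest $i$ with $z^{(i)}$ nonempty; let $\sigma^{(i)}$ be obtained from $z^{(i)}$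 by replacing each entry $i$ by $\mathrm{N}$ and each entry $i-1$ by $\mathrm{E}$. Then $\phi_{n,0,1}(P)$ is the path with word $\sigma^{(0)}\sigma^{(1)}\cdots\sigma^{(M)}$. -}

module Defs where

open import Data.Nat using (ℕ; zero; suc; _∸_; _≤_; _⊔_)
open import Data.Integer as ℤ using (ℤ; +_; -[1+_])
open import Data.List using (List; []; _∷_; _++_; map; reverse; upTo; concatMap; filterᵇ; take; length; foldr)
open import Data.Bool using (Bool; true; false; if_then_else_; _∨_)
open import Data.Product using (_×_; _,_; proj₁; proj₂)
open import Relation.Nullary using (does)
open import Relation.Binary.PropositionalEquality using (_≡_)

-- Unit steps: N = north, E = east.  A lattice path from (0,0) is identified with its word.
data Step : Set where
  N E : Step

Word : Set
Word = List Step

-- word(P): paths are represented by their words, so this is the identity.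
word : Word → Word
word w = w

flip : Word → Word
flip = map λ { N → E ; E → N }

rev : Word → Word
rev = reverse

#N #E : Word → ℕ
#N []      = 0
#N (N ∷ w) = suc (#N w)
#N (E ∷ w) = #N w
#E []      = 0
#E (N ∷ w) = #E w
#E (E ∷ w) = suc (#E w)

-- T_{n,0,1}: paths from (0,0) to (n,n) never strictly to the right of x = y,
-- i.e. every lattice point (x,y) visited (after each prefix) satisfies x ≤ y.
InT : ℕ → Word → Set
InT n w = (#E w ≡ n) × (#N w ≡ n) × (∀ k → #E (take k w) ≤ #N (take k w))

levels : ℤ → Word → List (ℤ × Step)
levels l []      = []
levels l (N ∷ w) = (l ℤ.+ ℤ.1ℤ , N) ∷ levels (l ℤ.+ ℤ.1ℤ) w
levels l (E ∷ w) = (l ℤ.- ℤ.1ℤ , E) ∷ levels (l ℤ.- ℤ.1ℤ) w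

-- order of k: -1, -2, ..., -len, then len, ..., 1, 0
-- (all levels lie in [-len, len], so this covers every occurring level)
levelOrder : ℕ → List ℤ
levelOrder m = map (λ j → -[1+ j ]) (upTo m) ++ map +_ (reverse (upTo (suc m)))

sw⁻ : Word → Word
sw⁻ w = concatMap (λ k → map proj₂ (filterᵇ (λ p → does (proj₁ p ℤ.≟ k)) (reverse (levels (+ 0) w))))
                  (levelOrder (length w))

-- The row i ≤ y ≤ i+1 is entered by the (i+1)-st N step, at x = x_i (number of E steps before it);
-- the complete squares to the right of P and left of x = y in that row are those [x,x+1]×[i,i+1]
-- with x_i ≤ x and x+1 ≤ i, so g_i = i ∸ x_i.
areaAux : ℕ → ℕ → Word → List ℕ
areaAux i x []      = []
areaAux i x (N ∷ w) = (i ∸ x) ∷ areaAux (suc i) x w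
areaAux i x (E ∷ w) = areaAux i (suc x) w

area : Word → List ℕ
area = areaAux 0 0

_==_ : ℕ → ℕ → Bool
m == n = does (m Data.Nat.≟ n)

σ : List ℕ → ℕ → Word
σ g i = map (λ x → if x == i then N else E) (filterᵇ (λ x → (x == i) ∨ (suc x == i)) g)

-- M = largest i with z^{(i)} nonempty = 1 + max g (for nonempty g)
maxL : List ℕ → ℕ
maxL = foldr _⊔_ 0

φ : Word → Word
φ P = concatMap (σ (area P)) (upTo (suc (suc (maxL (area P)))))

module Submission where

-- Read a path w in T_{n,0,1} as a walk of heights h = #N - #E,
-- starting and ending at 0 and never negative.  The area vector g(P) is
-- the list of heights at which the N steps of w start (`area-riseHeights`),
-- so σ^{(k)} lists, left to right, the N steps starting at height k
-- (written N) and those starting at height k-1 (written E).  On the other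
-- side, sw⁻ collects for each level k the letters of w *ending* at level
-- k, i.e. the N steps starting at k-1 and the E steps descending to k.
-- After flipping, an N step from k-1 becomes E, and an E step down to k
-- becomes N; since every N step from height k is eventually matched by a
-- later E step down to k, the two words coincide (`σ-levelWord`, proved by
-- induction along the walk together with the "one pending N" variant for
-- walks starting above k).  The theorem then follows by bookkeeping:
-- flip ∘ rev turns the level order -1,…,-m,m,…,0 into 0,…,m,-m,…,-1,
-- negative levels are never reached, and both sides may be truncated to
-- the heights 0,…,m because all later summands are empty.

open import Defs
open import Data.Nat using (ℕ; zero; suc; _+_; _∸_; _≤_; _<_; _≟_; z≤n; s≤s)
open import Data.Nat.Properties
  using ( ≤-refl; ≤-trans; <-trans; <⇒≤; <⇒≢; n<1+n; m≤m+n; +-suc; +-identityʳ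
        ; m+n∸n≡m; m≤m⊔n; m≤n⊔m; ≤-total; m≤n⇒m<n∨m≡n; m<1+n⇒m<n∨m≡n; suc-injective; 1+n≢n
        ; ≤-<-trans; n≤1+n; ≤-pred; +-comm; +-monoʳ-≤ )
open import Data.Integer as ℤ using (ℤ; +_; -[1+_])
open import Data.Integer.Properties using (+-injective)
open import Data.List
open import Data.List.Properties
  using ( filter-accept; filter-reject; filter-++; ++-identityʳ; upTo-∷ʳ; concatMap-++
        ; concatMap-map; map-concatMap; concatMap-cong; reverse-++; reverse-map
        ; reverse-involutive; unfold-reverse )
open import Data.Bool using (Bool; true; false; if_then_else_; _∨_; T)
open import Data.Product using (_×_; _,_; proj₁; proj₂)
open import Data.Sum using (inj₁; inj₂)
open import Data.Empty using (⊥)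
open import Data.Unit using (tt)
open import Function using (_∘_)
open import Relation.Nullary using (does)
open import Relation.Nullary.Decidable using (T?; dec-true; dec-false)
open import Relation.Binary.PropositionalEquality
  using (_≡_; _≢_; ≢-sym; refl; sym; trans; cong; cong₂; subst; module ≡-Reasoning)
open ≡-Reasoning

filterᵇ-accept : ∀ {A : Set} (p : A → Bool) {x : A} {xs : List A} →
                 p x ≡ true → filterᵇ p (x ∷ xs) ≡ x ∷ filterᵇ p xs
filterᵇ-accept p px = filter-accept (T? ∘ p) (subst T (sym px) tt)

filterᵇ-reject : ∀ {A : Set} (p : A → Bool) {x : A} {xs : List A} →
                 p x ≡ false → filterᵇ p (x ∷ xs) ≡ filterᵇ p xs
filterᵇ-reject p px = filter-reject (T? ∘ p) (subst T px)

filterᵇ-reverse : ∀ {A : Set} (p : A → Bool) (xs : List A) →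
                  filterᵇ p (reverse xs) ≡ reverse (filterᵇ p xs)
filterᵇ-reverse p []       = refl
filterᵇ-reverse p (x ∷ xs) = begin
  filterᵇ p (reverse (x ∷ xs))               ≡⟨ cong (filterᵇ p) (unfold-reverse x xs) ⟩
  filterᵇ p (reverse xs ++ [ x ])            ≡⟨ filter-++ (T? ∘ p) (reverse xs) [ x ] ⟩
  filterᵇ p (reverse xs) ++ filterᵇ p [ x ]  ≡⟨ cong (_++ filterᵇ p [ x ]) (filterᵇ-reverse p xs) ⟩
  reverse (filterᵇ p xs) ++ filterᵇ p [ x ]  ≡⟨ cong (reverse (filterᵇ p xs) ++_) singleton-self-reverse ⟩
  reverse (filterᵇ p xs) ++ reverse (filterᵇ p [ x ])  ≡⟨ sym (reverse-++ (filterᵇ p [ x ]) (filterᵇ p xs)) ⟩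
  reverse (filterᵇ p [ x ] ++ filterᵇ p xs)  ≡⟨ cong reverse (sym (filter-++ (T? ∘ p) [ x ] xs)) ⟩
  reverse (filterᵇ p (x ∷ xs))               ∎
  where
  -- a filtered singleton has at most one element, hence is its own reversal
  singleton-self-reverse : filterᵇ p [ x ] ≡ reverse (filterᵇ p [ x ])
  singleton-self-reverse with p x
  ... | true  = refl
  ... | false = refl

reverse-concatMap : ∀ {A B : Set} (f : A → List B) (xs : List A) →
                    reverse (concatMap f xs) ≡ concatMap (reverse ∘ f) (reverse xs)
reverse-concatMap f []       = refl
reverse-concatMap f (x ∷ xs) = begin
  reverse (f x ++ concatMap f xs)                         ≡⟨ reverse-++ (f x) (concatMap f xs) ⟩
  reverse (concatMap f xs) ++ reverse (f x)               ≡⟨ cong₂ _++_ (reverse-concatMap f xs) (sym (++-identityʳ _)) ⟩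
  concatMap (reverse ∘ f) (reverse xs) ++ concatMap (reverse ∘ f) [ x ]
                                                          ≡⟨ sym (concatMap-++ (reverse ∘ f) (reverse xs) [ x ]) ⟩
  concatMap (reverse ∘ f) (reverse xs ++ [ x ])           ≡⟨ cong (concatMap (reverse ∘ f)) (sym (unfold-reverse x xs)) ⟩
  concatMap (reverse ∘ f) (reverse (x ∷ xs))              ∎

concatMap-empty : ∀ {A B : Set} (f : A → List B) → (∀ x → f x ≡ []) → ∀ xs → concatMap f xs ≡ []
concatMap-empty f f≡[] []       = refl
concatMap-empty f f≡[] (x ∷ xs) = cong₂ _++_ (f≡[] x) (concatMap-empty f f≡[] xs)

concatMap-upTo-truncate : ∀ {A : Set} (F : ℕ → List A) {a} → (∀ k → a ≤ k → F k ≡ []) →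
                          ∀ {b} → a ≤ b → concatMap F (upTo b) ≡ concatMap F (upTo a)
concatMap-upTo-truncate F     vanish {zero}  z≤n = refl
concatMap-upTo-truncate F {a} vanish {suc b} a≤1+b with m≤n⇒m<n∨m≡n a≤1+b
... | inj₂ refl = refl
... | inj₁ (s≤s a≤b) = begin
  concatMap F (upTo (suc b))                  ≡⟨ cong (concatMap F) (sym (upTo-∷ʳ b)) ⟩
  concatMap F (upTo b ++ [ b ])               ≡⟨ concatMap-++ F (upTo b) [ b ] ⟩
  concatMap F (upTo b) ++ F b ++ []           ≡⟨ cong (λ ys → concatMap F (upTo b) ++ ys ++ []) (vanish b a≤b) ⟩
  concatMap F (upTo b) ++ []                  ≡⟨ ++-identityʳ _ ⟩
  concatMap F (upTo b)                        ≡⟨ concatMap-upTo-truncate F vanish a≤b ⟩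
  concatMap F (upTo a)                        ∎

concatMap-upTo-support : ∀ {A : Set} (F : ℕ → List A) {a b} →
                         (∀ k → a ≤ k → F k ≡ []) → (∀ k → b ≤ k → F k ≡ []) →
                         concatMap F (upTo a) ≡ concatMap F (upTo b)
concatMap-upTo-support F {a} {b} vanish-a vanish-b with ≤-total a b
... | inj₁ a≤b = sym (concatMap-upTo-truncate F vanish-a a≤b)
... | inj₂ b≤a = concatMap-upTo-truncate F vanish-b b≤a

-- Returning l w: the walk w (N = up, E = down) started at height l never
-- goes below height 0 and ends at height 0.  A path in T_{n,0,1} is a
-- returning walk from height 0.
Returning : ℕ → Word → Set
Returning l       []      = l ≡ 0
Returning l       (N ∷ w) = Returning (suc l) w
Returning zero    (E ∷ w) = ⊥
Returning (suc l) (E ∷ w) = Returning l w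

returning-from-prefixes : ∀ l w → (∀ k → #E (take k w) ≤ l + #N (take k w)) →
                          #E w ≡ l + #N w → Returning l w
returning-from-prefixes l       []      prefix final = sym (trans final (+-identityʳ l))
returning-from-prefixes l       (N ∷ w) prefix final =
  returning-from-prefixes (suc l) w (λ k → subst (#E (take k w) ≤_) (+-suc l _) (prefix (suc k)))
                                    (trans final (+-suc l (#N w)))
returning-from-prefixes zero    (E ∷ w) prefix final with prefix 1
... | ()
returning-from-prefixes (suc l) (E ∷ w) prefix final =
  returning-from-prefixes l w (λ k → ≤-pred (prefix (suc k))) (suc-injective final)

-- riseHeights l w: the heights from which the N steps of w start, in order
-- (the clause for an E step at height 0 never occurs on returning walks).
riseHeights : ℕ → Word → List ℕ
riseHeights l       []      = []
riseHeights l       (N ∷ w) = l ∷ riseHeights (suc l) w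
riseHeights zero    (E ∷ w) = riseHeights zero w
riseHeights (suc l) (E ∷ w) = riseHeights l w

-- The area of the row entered by an N step at (x, i) is i ∸ x, which is the
-- current height l = i - x; so the area vector lists the rise heights.
areaAux-riseHeights : ∀ i x l w → i ≡ l + x → Returning l w → areaAux i x w ≡ riseHeights l w
areaAux-riseHeights i x l       []      i≡l+x ret = refl
areaAux-riseHeights i x l       (N ∷ w) i≡l+x ret =
  cong₂ _∷_ (trans (cong (_∸ x) i≡l+x) (m+n∸n≡m l x))
            (areaAux-riseHeights (suc i) x (suc l) w (cong suc i≡l+x) ret)
areaAux-riseHeights i x zero    (E ∷ w) i≡l+x ()
areaAux-riseHeights i x (suc l) (E ∷ w) i≡l+x ret =
  areaAux-riseHeights i (suc x) l w (trans i≡l+x (sym (+-suc l x))) ret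

area-riseHeights : ∀ w → Returning 0 w → area w ≡ riseHeights 0 w
area-riseHeights w = areaAux-riseHeights 0 0 0 w refl

σ-keeps : ℕ → ℕ → Bool
σ-keeps k x = (x == k) ∨ (suc x == k)

σ-letter : ℕ → ℕ → Step
σ-letter k x = if x == k then N else E

σ-at : ∀ k g → σ (k ∷ g) k ≡ N ∷ σ g k
σ-at k g = begin
  map (σ-letter k) (filterᵇ (σ-keeps k) (k ∷ g))  ≡⟨ cong (map (σ-letter k)) (filterᵇ-accept (σ-keeps k) {k} {g} k-kept) ⟩
  σ-letter k k ∷ σ g k                            ≡⟨ cong (λ b → (if b then N else E) ∷ σ g k) k==k ⟩
  N ∷ σ g k                                       ∎
  where
  k==k : (k == k) ≡ true
  k==k = dec-true (k ≟ k) refl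
  k-kept : σ-keeps k k ≡ true
  k-kept = cong (_∨ (suc k == k)) k==k

σ-below : ∀ k g → σ (k ∷ g) (suc k) ≡ E ∷ σ g (suc k)
σ-below k g = begin
  map (σ-letter (suc k)) (filterᵇ (σ-keeps (suc k)) (k ∷ g))
    ≡⟨ cong (map (σ-letter (suc k))) (filterᵇ-accept (σ-keeps (suc k)) {k} {g} k-kept) ⟩
  σ-letter (suc k) k ∷ σ g (suc k)
    ≡⟨ cong (λ b → (if b then N else E) ∷ σ g (suc k)) k≠1+k ⟩
  E ∷ σ g (suc k) ∎
  where
  k≠1+k : (k == suc k) ≡ false
  k≠1+k = dec-false (k ≟ suc k) (λ k≡1+k → 1+n≢n (sym k≡1+k))
  k-kept : σ-keeps (suc k) k ≡ true
  k-kept = cong₂ _∨_ k≠1+k (dec-true (suc k ≟ suc k) refl)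

σ-skip : ∀ x k g → x ≢ k → suc x ≢ k → σ (x ∷ g) k ≡ σ g k
σ-skip x k g x≢k 1+x≢k =
  cong (map (σ-letter k)) (filterᵇ-reject (σ-keeps k) {x} {g} (cong₂ _∨_ (dec-false (x ≟ k) x≢k) (dec-false (suc x ≟ k) 1+x≢k)))

σ-beyond-max : ∀ g k → suc (suc (maxL g)) ≤ k → σ g k ≡ []
σ-beyond-max []      k _  = refl
σ-beyond-max (x ∷ g) k 2+max≤k =
  trans (σ-skip x k g (<⇒≢ x<k) (<⇒≢ 1+x<k)) (σ-beyond-max g k (≤-trans (s≤s (s≤s (m≤n⊔m x (maxL g)))) 2+max≤k))
  where
  1+x<k : suc x < k
  1+x<k = ≤-trans (s≤s (s≤s (m≤m⊔n x (maxL g)))) 2+max≤k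
  x<k : x < k
  x<k = <-trans (n<1+n x) 1+x<k

-- levelWord k z w: the letters of w whose level l_i (height after the
-- step, for the walk started at height z) equals k, from left to right.
-- sw⁻ is the concatenation of these words, read from right to left.
atLevel : ℤ → ℤ × Step → Bool
atLevel k p = does (proj₁ p ℤ.≟ k)

levelWord : ℤ → ℤ → Word → Word
levelWord k z w = map proj₂ (filterᵇ (atLevel k) (levels z w))

levels-N : ∀ l w → levels (+ l) (N ∷ w) ≡ (+ suc l , N) ∷ levels (+ suc l) w
levels-N l w = cong (λ z → (z , N) ∷ levels z w) (cong +_ (+-comm l 1))

levelWord-N-at : ∀ l w → levelWord (+ suc l) (+ l) (N ∷ w) ≡ N ∷ levelWord (+ suc l) (+ suc l) w
levelWord-N-at l w = begin
  map proj₂ (filterᵇ (atLevel (+ suc l)) (levels (+ l) (N ∷ w)))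
    ≡⟨ cong (map proj₂ ∘ filterᵇ (atLevel (+ suc l))) (levels-N l w) ⟩
  map proj₂ (filterᵇ (atLevel (+ suc l)) ((+ suc l , N) ∷ levels (+ suc l) w))
    ≡⟨ cong (map proj₂) (filterᵇ-accept (atLevel (+ suc l)) {+ suc l , N} {levels (+ suc l) w}
                                        (dec-true (+ suc l ℤ.≟ + suc l) refl)) ⟩
  N ∷ levelWord (+ suc l) (+ suc l) w ∎

levelWord-N-skip : ∀ k l w → suc l ≢ k → levelWord (+ k) (+ l) (N ∷ w) ≡ levelWord (+ k) (+ suc l) w
levelWord-N-skip k l w 1+l≢k = begin
  map proj₂ (filterᵇ (atLevel (+ k)) (levels (+ l) (N ∷ w)))
    ≡⟨ cong (map proj₂ ∘ filterᵇ (atLevel (+ k))) (levels-N l w) ⟩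
  map proj₂ (filterᵇ (atLevel (+ k)) ((+ suc l , N) ∷ levels (+ suc l) w))
    ≡⟨ cong (map proj₂) (filterᵇ-reject (atLevel (+ k)) {+ suc l , N} {levels (+ suc l) w}
                                        (dec-false (+ suc l ℤ.≟ + k) (1+l≢k ∘ +-injective))) ⟩
  levelWord (+ k) (+ suc l) w ∎

levelWord-E-at : ∀ l w → levelWord (+ l) (+ suc l) (E ∷ w) ≡ E ∷ levelWord (+ l) (+ l) w
levelWord-E-at l w =
  cong (map proj₂) (filterᵇ-accept (atLevel (+ l)) {+ l , E} {levels (+ l) w} (dec-true (+ l ℤ.≟ + l) refl))

levelWord-E-skip : ∀ k l w → l ≢ k → levelWord (+ k) (+ suc l) (E ∷ w) ≡ levelWord (+ k) (+ l) w
levelWord-E-skip k l w l≢k =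
  cong (map proj₂) (filterᵇ-reject (atLevel (+ k)) {+ l , E} {levels (+ l) w} (dec-false (+ l ℤ.≟ + k) (l≢k ∘ +-injective)))

-- On a returning walk from height l ≤ k, σ^{(k)} of the
-- rise heights is the flipped level-k word: an N step from k (letter N in
-- σ) is followed by its matching E step down to k (letter N after
-- flipping), and an N step from k-1 gives E on both sides.  If the walk
-- starts above k, the flipped level-k word has one extra N in front: the
-- first descent to level k, which is not matched by any earlier rise.
σ-levelWord : ∀ k l w → l ≤ k → Returning l w → σ (riseHeights l w) k ≡ flip (levelWord (+ k) (+ l) w)
σ-levelWord-pending : ∀ k l w → k < l → Returning l w → flip (levelWord (+ k) (+ l) w) ≡ N ∷ σ (riseHeights l w) k

σ-levelWord k l       []      l≤k ret = refl
σ-levelWord k l       (N ∷ w) l≤k ret with m≤n⇒m<n∨m≡n l≤k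
... | inj₂ refl = begin
  σ (l ∷ riseHeights (suc l) w) l          ≡⟨ σ-at l _ ⟩
  N ∷ σ (riseHeights (suc l) w) l          ≡⟨ sym (σ-levelWord-pending l (suc l) w (n<1+n l) ret) ⟩
  flip (levelWord (+ l) (+ suc l) w)       ≡⟨ cong flip (sym (levelWord-N-skip l l w 1+n≢n)) ⟩
  flip (levelWord (+ l) (+ l) (N ∷ w))     ∎
... | inj₁ l<k with m≤n⇒m<n∨m≡n l<k
...   | inj₂ refl = begin
  σ (l ∷ riseHeights (suc l) w) (suc l)          ≡⟨ σ-below l _ ⟩
  E ∷ σ (riseHeights (suc l) w) (suc l)          ≡⟨ cong (E ∷_) (σ-levelWord (suc l) (suc l) w ≤-refl ret) ⟩
  flip (N ∷ levelWord (+ suc l) (+ suc l) w)     ≡⟨ cong flip (sym (levelWord-N-at l w)) ⟩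
  flip (levelWord (+ suc l) (+ l) (N ∷ w))       ∎
...   | inj₁ 1+l<k = begin
  σ (l ∷ riseHeights (suc l) w) k          ≡⟨ σ-skip l k _ (<⇒≢ l<k) (<⇒≢ 1+l<k) ⟩
  σ (riseHeights (suc l) w) k              ≡⟨ σ-levelWord k (suc l) w (<⇒≤ 1+l<k) ret ⟩
  flip (levelWord (+ k) (+ suc l) w)       ≡⟨ cong flip (sym (levelWord-N-skip k l w (<⇒≢ 1+l<k))) ⟩
  flip (levelWord (+ k) (+ l) (N ∷ w))     ∎
σ-levelWord k zero    (E ∷ w) l≤k ()
σ-levelWord k (suc l) (E ∷ w) l<k ret = begin
  σ (riseHeights l w) k                    ≡⟨ σ-levelWord k l w (<⇒≤ l<k) ret ⟩
  flip (levelWord (+ k) (+ l) w)           ≡⟨ cong flip (sym (levelWord-E-skip k l w (<⇒≢ l<k))) ⟩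
  flip (levelWord (+ k) (+ suc l) (E ∷ w)) ∎

σ-levelWord-pending k .zero   []      () refl
σ-levelWord-pending k l       (N ∷ w) k<l ret = begin
  flip (levelWord (+ k) (+ l) (N ∷ w))     ≡⟨ cong flip (levelWord-N-skip k l w (≢-sym (<⇒≢ k<1+l))) ⟩
  flip (levelWord (+ k) (+ suc l) w)       ≡⟨ σ-levelWord-pending k (suc l) w k<1+l ret ⟩
  N ∷ σ (riseHeights (suc l) w) k          ≡⟨ cong (N ∷_) (sym (σ-skip l k _ (≢-sym (<⇒≢ k<l)) (≢-sym (<⇒≢ k<1+l)))) ⟩
  N ∷ σ (l ∷ riseHeights (suc l) w) k      ∎
  where
  k<1+l : k < suc l
  k<1+l = <-trans k<l (n<1+n l)
σ-levelWord-pending k zero    (E ∷ w) k<l ()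
σ-levelWord-pending k (suc l) (E ∷ w) k<1+l ret with m<1+n⇒m<n∨m≡n k<1+l
... | inj₂ refl = begin
  flip (levelWord (+ k) (+ suc k) (E ∷ w)) ≡⟨ cong flip (levelWord-E-at k w) ⟩
  N ∷ flip (levelWord (+ k) (+ k) w)       ≡⟨ cong (N ∷_) (sym (σ-levelWord k k w ≤-refl ret)) ⟩
  N ∷ σ (riseHeights k w) k                ∎
... | inj₁ k<l = begin
  flip (levelWord (+ k) (+ suc l) (E ∷ w)) ≡⟨ cong flip (levelWord-E-skip k l w (≢-sym (<⇒≢ k<l))) ⟩
  flip (levelWord (+ k) (+ l) w)           ≡⟨ σ-levelWord-pending k l w k<l ret ⟩
  N ∷ σ (riseHeights l w) k                ∎

levelWord-beyond : ∀ k l w → Returning l w → l + length w < k → levelWord (+ k) (+ l) w ≡ []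
levelWord-beyond k l       []      ret bound = refl
levelWord-beyond k l       (N ∷ w) ret bound =
  trans (levelWord-N-skip k l w (<⇒≢ (≤-<-trans (m≤m+n (suc l) (length w)) bound′)))
        (levelWord-beyond k (suc l) w ret bound′)
  where
  bound′ : suc l + length w < k
  bound′ = subst (_< k) (+-suc l (length w)) bound
levelWord-beyond k zero    (E ∷ w) ()  bound
levelWord-beyond k (suc l) (E ∷ w) ret bound =
  trans (levelWord-E-skip k l w (<⇒≢ (≤-<-trans (m≤m+n l (length w)) bound′)))
        (levelWord-beyond k l w ret bound′)
  where
  bound′ : l + length w < k
  bound′ = ≤-<-trans (≤-trans (+-monoʳ-≤ l (n≤1+n (length w))) (n≤1+n _)) bound

levelWord-negative : ∀ j l w → Returning l w → levelWord -[1+ j ] (+ l) w ≡ []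
levelWord-negative j l       []      ret = refl
levelWord-negative j l       (N ∷ w) ret =
  trans (cong (map proj₂ ∘ filterᵇ (atLevel -[1+ j ])) (levels-N l w)) (levelWord-negative j (suc l) w ret)
levelWord-negative j zero    (E ∷ w) ()
levelWord-negative j (suc l) (E ∷ w) ret = levelWord-negative j l w ret

flip-rev-sw⁻ : ∀ w → flip (rev (sw⁻ w)) ≡
               concatMap (λ k → flip (levelWord k (+ 0) w)) (reverse (levelOrder (length w)))
flip-rev-sw⁻ w = begin
  flip (reverse (concatMap rightToLeft order))              ≡⟨ cong flip (reverse-concatMap rightToLeft order) ⟩
  flip (concatMap (reverse ∘ rightToLeft) (reverse order))  ≡⟨ map-concatMap _ (reverse ∘ rightToLeft) (reverse order) ⟩
  concatMap (flip ∘ reverse ∘ rightToLeft) (reverse order)  ≡⟨ concatMap-cong (cong flip ∘ reverse-rightToLeft) (reverse order) ⟩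
  concatMap (λ k → flip (levelWord k (+ 0) w)) (reverse order) ∎
  where
  order : List ℤ
  order = levelOrder (length w)
  rightToLeft : ℤ → Word
  rightToLeft k = map proj₂ (filterᵇ (atLevel k) (reverse (levels (+ 0) w)))
  reverse-rightToLeft : ∀ k → reverse (rightToLeft k) ≡ levelWord k (+ 0) w
  reverse-rightToLeft k = begin
    reverse (map proj₂ (filterᵇ (atLevel k) (reverse L)))    ≡⟨ cong (reverse ∘ map proj₂) (filterᵇ-reverse (atLevel k) L) ⟩
    reverse (map proj₂ (reverse (filterᵇ (atLevel k) L)))    ≡⟨ cong reverse (reverse-map proj₂ (filterᵇ (atLevel k) L)) ⟩
    reverse (reverse (map proj₂ (filterᵇ (atLevel k) L)))    ≡⟨ reverse-involutive _ ⟩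
    map proj₂ (filterᵇ (atLevel k) L)                        ∎
    where
    L : List (ℤ × Step)
    L = levels (+ 0) w

reverse-levelOrder : ∀ m → reverse (levelOrder m) ≡ map +_ (upTo (suc m)) ++ map -[1+_] (reverse (upTo m))
reverse-levelOrder m = begin
  reverse (map -[1+_] (upTo m) ++ map +_ (reverse (upTo (suc m))))
    ≡⟨ reverse-++ (map -[1+_] (upTo m)) _ ⟩
  reverse (map +_ (reverse (upTo (suc m)))) ++ reverse (map -[1+_] (upTo m))
    ≡⟨ cong₂ _++_ (sym (reverse-map +_ (reverse (upTo (suc m))))) (sym (reverse-map -[1+_] (upTo m))) ⟩
  map +_ (reverse (reverse (upTo (suc m)))) ++ map -[1+_] (reverse (upTo m))
    ≡⟨ cong (λ xs → map +_ xs ++ map -[1+_] (reverse (upTo m))) (reverse-involutive (upTo (suc m))) ⟩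
  map +_ (upTo (suc m)) ++ map -[1+_] (reverse (upTo m)) ∎

flip-rev-sw⁻-heights : ∀ w → Returning 0 w →
  flip (rev (sw⁻ w)) ≡ concatMap (λ k → flip (levelWord (+ k) (+ 0) w)) (upTo (suc (length w)))
flip-rev-sw⁻-heights w ret = begin
  flip (rev (sw⁻ w))                                          ≡⟨ flip-rev-sw⁻ w ⟩
  concatMap G (reverse (levelOrder m))                        ≡⟨ cong (concatMap G) (reverse-levelOrder m) ⟩
  concatMap G (map +_ (upTo (suc m)) ++ map -[1+_] negatives) ≡⟨ concatMap-++ G (map +_ (upTo (suc m))) _ ⟩
  concatMap G (map +_ (upTo (suc m))) ++ concatMap G (map -[1+_] negatives)
    ≡⟨ cong₂ _++_ (concatMap-map G +_ (upTo (suc m))) (concatMap-map G -[1+_] negatives) ⟩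
  concatMap (G ∘ +_) (upTo (suc m)) ++ concatMap (G ∘ -[1+_]) negatives
    ≡⟨ cong (concatMap (G ∘ +_) (upTo (suc m)) ++_)
            (concatMap-empty (G ∘ -[1+_]) (λ j → cong flip (levelWord-negative j 0 w ret)) negatives) ⟩
  concatMap (G ∘ +_) (upTo (suc m)) ++ []                     ≡⟨ ++-identityʳ _ ⟩
  concatMap (G ∘ +_) (upTo (suc m))                           ∎
  where
  m : ℕ
  m = length w
  negatives : List ℕ
  negatives = reverse (upTo m)
  G : ℤ → Word
  G k = flip (levelWord k (+ 0) w)

-- Both sides are
-- concatenations over the heights k: σ^{(k)} on the left, the flipped
-- level-k word on the right; they agree blockwise by the key matching,
-- and both may be truncated to k ≤ |P|.
theorem4p3 : (n : ℕ) → 0 < n → (P : Word) → InT n P →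
             word (φ P) ≡ flip (rev (sw⁻ (word P)))
theorem4p3 n _ P (#E≡n , #N≡n , below-diagonal) = begin
  φ P
    ≡⟨ cong (λ h → concatMap (σ h) (upTo (suc (suc (maxL h))))) (area-riseHeights P ret) ⟩
  concatMap (σ g) (upTo (suc (suc (maxL g))))
    ≡⟨ concatMap-upTo-support (σ g) (σ-beyond-max g) σ-beyond-length ⟩
  concatMap (σ g) (upTo (suc m))
    ≡⟨ concatMap-cong (λ k → σ-levelWord k 0 P z≤n ret) (upTo (suc m)) ⟩
  concatMap (λ k → flip (levelWord (+ k) (+ 0) P)) (upTo (suc m))
    ≡⟨ sym (flip-rev-sw⁻-heights P ret) ⟩
  flip (rev (sw⁻ P)) ∎
  where
  ret : Returning 0 P
  ret = returning-from-prefixes 0 P below-diagonal (trans #E≡n (sym #N≡n))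
  g : List ℕ
  g = riseHeights 0 P
  m : ℕ
  m = length P
  σ-beyond-length : ∀ k → suc m ≤ k → σ g k ≡ []
  σ-beyond-length k m<k = trans (σ-levelWord k 0 P z≤n ret) (cong flip (levelWord-beyond k 0 P ret m<k))
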